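{- Let $D$ be a strongly connected semicomplete multipartite digraph. Then every maximum G-cycle of $D$ is spanning.
   Context: All digraphs are finite, without loops or parallel arcs (2-cycles allowed). A digraph $D$ is a semicomplete multipartite digraph if $V(D)$ has a partition into nonempty sets (partite sets) such that no arc has both ends in the same set and any two vertices in different partite sets are joined by at least one arc. A G-cycle of $D$ is either a directed cycle of $D$, or a sequence of $r\ge1$ pairwise vertex-disjoint directed paths $P_1,\ldots,P_r$ of $D$ (a path may be a single vertex), $P_i$ from $u_i$ to $v_i$, such that $v_i$ and $u_{i+1}$ lie in the same partite set for every $i\in[r]$, where $u_{r+1}=u_1$. Its length is the number of arcs of $D$ it uses. A G-cycle is longest if it has maximum length among all G-cycles of $D$, and maximum if it is longest and has the maximum number of vertices among all longest G-cycles of $D$. It is spanning if it contains all vertices of $D$. -}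

module Defs where

open import Data.Nat using (ℕ; _≤_; _∸_; _+_)
open import Data.Fin using (Fin)
open import Data.Product using (_×_; Σ; ∃)
open import Data.Sum using (_⊎_)
open import Data.List using (List; []; _∷_; length; concat; map)
open import Data.Nat.ListAction using (sum)
open import Data.List.NonEmpty as L⁺ using (List⁺; _∷_; toList)
open import Data.List.Relation.Unary.All using (All)
open import Data.List.Relation.Unary.Unique.Propositional using (Unique)
open import Data.List.Relation.Unary.Linked using (Linked)
open import Data.List.Membership.Propositional using (_∈_)
open import Relation.Binary.PropositionalEquality using (_≡_; _≢_)
open import Relation.Binary.Construct.Closure.ReflexiveTransitive using (Star)
open import Relation.Nullary using (¬_)

-- A digraph on vertex set Fin n: an arc relation without loops
-- (a relation, so no parallel arcs; 2-cycles allowed).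
record Digraph (n : ℕ) : Set₁ where
  field
    Arc     : Fin n → Fin n → Set
    noLoops : ∀ v → ¬ Arc v v
open Digraph public

record IsSMD {n : ℕ} (D : Digraph n) (k : ℕ) (part : Fin n → Fin k) : Set where
  field
    nonemptyParts : ∀ (i : Fin k) → ∃ λ v → part v ≡ i
    independent   : ∀ u v → part u ≡ part v → ¬ Arc D u v
    semicomplete  : ∀ u v → part u ≢ part v → Arc D u v ⊎ Arc D v u

StronglyConnected : ∀ {n} → Digraph n → Set
StronglyConnected {n} D = ∀ (u v : Fin n) → Star (Arc D) u v

CycLinked : ∀ {A : Set} → (A → A → Set) → List⁺ A → Set
CycLinked R xs = Linked R (toList xs) × R (L⁺.last xs) (L⁺.head xs)

-- Raw G-cycles: a directed cycle given by its vertex sequence, or a nonempty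
-- sequence P₁,…,P_r of paths, each given by its nonempty vertex sequence.
data GCycle (n : ℕ) : Set where
  cycle : List⁺ (Fin n) → GCycle n
  paths : List⁺ (List⁺ (Fin n)) → GCycle n

vertices : ∀ {n} → GCycle n → List (Fin n)
vertices (cycle vs) = toList vs
vertices (paths ps) = concat (map toList (toList ps))

gLength : ∀ {n} → GCycle n → ℕ
gLength (cycle vs) = L⁺.length vs
gLength (paths ps) = sum (map (λ P → L⁺.length P ∸ 1) (toList ps))

gOrder : ∀ {n} → GCycle n → ℕ
gOrder g = length (vertices g)

IsPath : ∀ {n} → Digraph n → List⁺ (Fin n) → Set
IsPath D P = Unique (toList P) × Linked (Arc D) (toList P)

IsGCycle : ∀ {n k} → Digraph n → (Fin n → Fin k) → GCycle n → Set
IsGCycle D part (cycle vs) =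
  (2 ≤ L⁺.length vs) × Unique (toList vs) × CycLinked (Arc D) vs
IsGCycle D part (paths ps) =
  All (IsPath D) (toList ps)
  × Unique (concat (map toList (toList ps)))
  × CycLinked (λ P Q → part (L⁺.last P) ≡ part (L⁺.head Q)) ps

IsLongest : ∀ {n k} → Digraph n → (Fin n → Fin k) → GCycle n → Set
IsLongest D part g =
  IsGCycle D part g × (∀ g′ → IsGCycle D part g′ → gLength g′ ≤ gLength g)

IsMaximum : ∀ {n k} → Digraph n → (Fin n → Fin k) → GCycle n → Set
IsMaximum D part g =
  IsLongest D part g
  × (∀ g′ → IsLongest D part g′ → gOrder g′ ≤ gOrder g)

Spanning : ∀ {n} → GCycle n → Set
Spanning {n} g = ∀ (v : Fin n) → v ∈ vertices g

-- View a G-cycle as a closed walk through distinct vertices whose steps are arcs or jumps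
-- inside a partite set, its length being the number of arcs. Let C be a maximum one and v a
-- vertex outside C. If x → v and v → y (or v, y lie in one partite set) for consecutive x, y
-- on C, inserting v between x and y gives a G-cycle that is at least as long and has more
-- vertices. Hence, by semicompleteness, if one vertex of C dominates v then, going around C,
-- every vertex of C dominates v. Likewise, if C dominates z ∉ C and z → z′ ∉ C, then C
-- dominates z′ (else insert z z′), and z has no arc into C (else insert z before the head of
-- that arc). So a walk from C to v, which exists by strong connectivity, makes v dominated
-- by C, and no walk leads back from v to C.

module Submission where

open import Defs
open import Data.Nat using (ℕ; suc; _+_; _≤_; _∸_; z≤n; s≤s)
open import Data.Nat.Properties
  using ( +-assoc; +-comm; +-identityʳ; +-mono-≤; +-monoʳ-≤; m≤n+m; m<n+m; <⇒≱
        ; ≤-refl; ≤-reflexive; ≤-trans; module ≤-Reasoning)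
open import Data.Fin using (Fin) renaming (_≟_ to _≟ᶠ_)
open import Data.Product using (Σ; ∃; _×_; _,_; proj₁; proj₂; map₂)
open import Data.Sum using (_⊎_; inj₁; inj₂)
import Data.Sum as Sum
open import Data.Empty using (⊥; ⊥-elim)
open import Data.List using (List; []; _∷_; _++_; length; concat; map)
import Data.List as List
open import Data.List.Properties using (length-++)
open import Data.Nat.ListAction using (sum)
open import Data.List.NonEmpty as L⁺ using (List⁺; _∷_; _∷⁺_; toList)
open import Data.List.Relation.Unary.All as All using (All; []; _∷_)
import Data.List.Relation.Unary.All.Properties as All
open import Data.List.Relation.Unary.Any using (here; there)
open import Data.List.Relation.Unary.AllPairs using ([]; _∷_)
open import Data.List.Relation.Unary.Unique.Propositional using (Unique)
open import Data.List.Relation.Unary.Unique.Propositional.Properties using (++⁺)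
open import Data.List.Relation.Unary.Linked as Linked using (Linked; [-]; _∷_)
open import Data.List.Membership.Propositional using (_∈_; _∉_)
open import Data.List.Relation.Binary.Disjoint.Propositional using (Disjoint)
open import Data.List.Membership.Propositional.Properties using (∈-++⁺ʳ)
open import Data.List.Relation.Binary.Permutation.Propositional
  using (_↭_; ↭-sym; ↭-trans; ↭⇒↭ₛ; module PermutationReasoning)
open import Data.List.Relation.Binary.Permutation.Propositional.Properties
  using (↭-length; ++⁺ˡ; ++-comm; shift; shifts; ∷↭∷ʳ)
import Data.List.Relation.Binary.Permutation.Setoid.Properties as Permutationₛ
open import Relation.Binary.PropositionalEquality
open import Relation.Binary.Construct.Closure.ReflexiveTransitive using (Star; ε; _◅_; _◅◅_)
open import Relation.Nullary using (yes; no)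

module _ {A : Set} where

  last-∷ : ∀ (x y : A) ys → L⁺.last (x ∷ y ∷ ys) ≡ L⁺.last (y ∷ ys)
  last-∷ x y ys with List.initLast ys
  ... | List.[] = refl
  ... | _ List.∷ʳ′ _ = refl

  -- L⁺.last goes through snocView and is stuck on x ∷ y ∷ ys; this one computes.
  lastOf : A → List A → A
  lastOf x [] = x
  lastOf _ (y ∷ ys) = lastOf y ys

  last≡lastOf : ∀ x xs → L⁺.last (x ∷ xs) ≡ lastOf x xs
  last≡lastOf x [] = refl
  last≡lastOf x (y ∷ ys) = trans (last-∷ x y ys) (last≡lastOf y ys)

  Unique-resp-↭ : ∀ {xs ys : List A} → xs ↭ ys → Unique xs → Unique ys
  Unique-resp-↭ p = Permutationₛ.Unique-resp-↭ (setoid A) (↭⇒↭ₛ p)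

  unique-++⁻ˡ : ∀ xs {ys : List A} → Unique (xs ++ ys) → Unique xs
  unique-++⁻ˡ [] _ = []
  unique-++⁻ˡ (x ∷ xs) (x∉ ∷ u) = All.++⁻ˡ xs x∉ ∷ unique-++⁻ˡ xs u

  unique-++⁻ʳ : ∀ xs {ys : List A} → Unique (xs ++ ys) → Unique ys
  unique-++⁻ʳ [] u = u
  unique-++⁻ʳ (x ∷ xs) (_ ∷ u) = unique-++⁻ʳ xs u

  unique-concat⁻ : ∀ (xss : List (List A)) → Unique (concat xss) → All Unique xss
  unique-concat⁻ [] _ = []
  unique-concat⁻ (xs ∷ xss) u = unique-++⁻ˡ xs u ∷ unique-concat⁻ xss (unique-++⁻ʳ xs u)

module _ {A : Set} {R : A → A → Set} where

  sources : ∀ {a b} → Star R a b → List A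
  sources ε = []
  sources {a} (_ ◅ w) = a ∷ sources w

  sources-◅◅ : ∀ {a b c} (v : Star R a b) (w : Star R b c) →
    sources (v ◅◅ w) ≡ sources v ++ sources w
  sources-◅◅ ε w = refl
  sources-◅◅ {a} (r ◅ v) w = cong (a ∷_) (sources-◅◅ v w)

  sources-◅◅-comm : ∀ {a b} (v : Star R a b) (w : Star R b a) →
    sources (v ◅◅ w) ↭ sources (w ◅◅ v)
  sources-◅◅-comm v w = begin
    sources (v ◅◅ w)        ≡⟨ sources-◅◅ v w ⟩
    sources v ++ sources w  ↭⟨ ++-comm (sources v) (sources w) ⟩
    sources w ++ sources v  ≡⟨ sources-◅◅ w v ⟨
    sources (w ◅◅ v)        ∎
    where open PermutationReasoning

  record Link {a b} (w : Star R a b) (x y : A) : Set where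
    constructor link
    field
      before : Star R a x
      step   : R x y
      after  : Star R y b
      split  : w ≡ before ◅◅ step ◅ after

  first-link : ∀ {a b c} (r : R a b) (w : Star R b c) → Link (r ◅ w) a b
  first-link r w = link ε r w refl

  link-◅ : ∀ {z a b x y} {r : R z a} {w : Star R a b} → Link w x y → Link (r ◅ w) x y
  link-◅ {r = r} (link c s d e) = link (r ◅ c) s d (cong (r ◅_) e)

  link-source∈ : ∀ {a b x y} {w : Star R a b} → Link w x y → x ∈ sources w
  link-source∈ (link c s d refl) rewrite sources-◅◅ c (s ◅ d) =
    ∈-++⁺ʳ (sources c) (here refl)

  final-link : ∀ {a b c} (r : R a b) (w : Star R b c) → ∃ λ x → Link (r ◅ w) x c
  final-link r ε = _ , first-link r ε
  final-link r (s ◅ w) = map₂ link-◅ (final-link s w)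

  inner-link : ∀ {z a b y} (r : R z a) (w : Star R a b) → y ∈ sources w →
    ∃ λ x → Link (r ◅ w) x y
  inner-link r (s ◅ w) (here refl) = _ , first-link r (s ◅ w)
  inner-link r (s ◅ w) (there y∈) = map₂ link-◅ (inner-link s w y∈)

  predecessor : ∀ {a y} (w : Star R a a) → y ∈ sources w → ∃ λ x → Link w x y
  predecessor (r ◅ w) (here refl) = final-link r w
  predecessor (r ◅ w) (there y∈) = inner-link r w y∈

  PreservedAlong : (A → Set) → ∀ {a b} → Star R a b → Set
  PreservedAlong P w = ∀ {x y} → Link w x y → P x → P y

  module _ {P : A → Set} where

    preserved-to-end : ∀ {a b} (w : Star R a b) → PreservedAlong P w → P a → P b
    preserved-to-end ε _ p = p
    preserved-to-end (r ◅ w) pres p =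
      preserved-to-end w (λ l → pres (link-◅ l)) (pres (first-link r w) p)

    preserved-from-source : ∀ {a b x} (w : Star R a b) → PreservedAlong P w →
      x ∈ sources w → P x → P b
    preserved-from-source (r ◅ w) pres (here refl) p = preserved-to-end (r ◅ w) pres p
    preserved-from-source (r ◅ w) pres (there x∈) p =
      preserved-from-source w (λ l → pres (link-◅ l)) x∈ p

    preserved-to-sources : ∀ {a b y} (w : Star R a b) → PreservedAlong P w →
      P a → y ∈ sources w → P y
    preserved-to-sources (r ◅ w) pres p (here refl) = p
    preserved-to-sources (r ◅ w) pres p (there y∈) =
      preserved-to-sources w (λ l → pres (link-◅ l)) (pres (first-link r w) p) y∈

    preserved-around : ∀ {a x y} (w : Star R a a) → PreservedAlong P w →
      x ∈ sources w → P x → y ∈ sources w → P y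
    preserved-around w pres x∈ p =
      preserved-to-sources w pres (preserved-from-source w pres x∈ p)

  linked-walk : ∀ {x xs u} → Linked R (x ∷ xs) → R (lastOf x xs) u → Star R x u
  linked-walk [-] r = r ◅ ε
  linked-walk (s ∷ l) r = s ◅ linked-walk l r

  sources-linked-walk : ∀ {x xs u} (l : Linked R (x ∷ xs)) (r : R (lastOf x xs) u) →
    sources (linked-walk l r) ≡ x ∷ xs
  sources-linked-walk [-] r = refl
  sources-linked-walk {x} (s ∷ l) r = cong (x ∷_) (sources-linked-walk l r)

  walk-linked : ∀ {x y u} (r : R x y) (w : Star R y u) →
    Linked R (x ∷ sources w) × R (L⁺.last (x ∷ sources w)) u
  walk-linked r ε = [-] , r
  walk-linked {x} {y} {u} r (s ◅ w) with walk-linked s w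
  ... | l , closing = r ∷ l , subst (λ t → R t u) (sym (last-∷ x y (sources w))) closing

module _ {n k : ℕ} (D : Digraph n) (part : Fin n → Fin k) where

  -- The inj₂ steps are the jumps between consecutive paths of a G-cycle.
  Step : Fin n → Fin n → Set
  Step u v = Arc D u v ⊎ part u ≡ part v

  Walk : Fin n → Fin n → Set
  Walk = Star Step

  weight : ∀ {u v} → Step u v → ℕ
  weight (inj₁ _) = 1
  weight (inj₂ _) = 0

  weight≤1 : ∀ {u v} (s : Step u v) → weight s ≤ 1
  weight≤1 (inj₁ _) = ≤-refl
  weight≤1 (inj₂ _) = z≤n

  arcs : ∀ {u v} → Walk u v → ℕ
  arcs ε = 0
  arcs (s ◅ w) = weight s + arcs w

  arcs-◅◅ : ∀ {a b c} (v : Walk a b) (w : Walk b c) → arcs (v ◅◅ w) ≡ arcs v + arcs w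
  arcs-◅◅ ε w = refl
  arcs-◅◅ (s ◅ v) w =
    trans (cong (weight s +_) (arcs-◅◅ v w)) (sym (+-assoc (weight s) (arcs v) (arcs w)))

  arcs-◅◅-comm : ∀ {a b} (v : Walk a b) (w : Walk b a) → arcs (v ◅◅ w) ≡ arcs (w ◅◅ v)
  arcs-◅◅-comm v w =
    trans (arcs-◅◅ v w) (trans (+-comm (arcs v) (arcs w)) (sym (arcs-◅◅ w v)))

  IsMaximalTour : ∀ {a} → Walk a a → Set
  IsMaximalTour w = Unique (sources w)
    × (∀ {b} (w′ : Walk b b) → Unique (sources w′) → arcs w ≤ arcs w′ →
       length (sources w′) ≤ length (sources w))

  insert-detour : ∀ {a x y u} {w : Walk a a} → Link w x y → Arc D x u → (d : Walk u y) →
    Unique (sources w) → Unique (sources d) → All (_∉ sources w) (sources d) →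
    Σ (Walk a a) λ w′ → Unique (sources w′) × arcs w ≤ arcs w′
      × length (sources d) + length (sources w) ≡ length (sources w′)
  insert-detour {a} {x} (link c s e refl) xu d distinct distinct-d fresh =
    w′ , Unique-resp-↭ (↭-sym perm) (++⁺ distinct-d distinct disjoint)
       , heavier , sym (trans (↭-length perm) (length-++ (sources d)))
    where
    w′ : Walk a a
    w′ = c ◅◅ inj₁ xu ◅ d ◅◅ e

    disjoint : Disjoint (sources d) (sources (c ◅◅ s ◅ e))
    disjoint (v∈d , v∈w) = All.lookup fresh v∈d v∈w

    perm : sources w′ ↭ sources d ++ sources (c ◅◅ s ◅ e)
    perm = begin
      sources w′
        ≡⟨ sources-◅◅ c _ ⟩
      sources c ++ x ∷ sources (d ◅◅ e)
        ≡⟨ cong (λ t → sources c ++ x ∷ t) (sources-◅◅ d e) ⟩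
      sources c ++ x ∷ sources d ++ sources e
        ↭⟨ ++⁺ˡ (sources c) (↭-sym (shift x (sources d) (sources e))) ⟩
      sources c ++ sources d ++ x ∷ sources e
        ↭⟨ shifts (sources c) (sources d) ⟩
      sources d ++ sources c ++ x ∷ sources e
        ≡⟨ cong (sources d ++_) (sources-◅◅ c (s ◅ e)) ⟨
      sources d ++ sources (c ◅◅ s ◅ e)
        ∎
      where open PermutationReasoning

    heavier : arcs (c ◅◅ s ◅ e) ≤ arcs w′
    heavier = begin
      arcs (c ◅◅ s ◅ e)
        ≡⟨ arcs-◅◅ c (s ◅ e) ⟩
      arcs c + (weight s + arcs e)
        ≤⟨ +-monoʳ-≤ (arcs c) (+-mono-≤ (weight≤1 s) (m≤n+m (arcs e) (arcs d))) ⟩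
      arcs c + (1 + (arcs d + arcs e))
        ≡⟨ cong (λ t → arcs c + (1 + t)) (arcs-◅◅ d e) ⟨
      arcs c + arcs (inj₁ xu ◅ d ◅◅ e)
        ≡⟨ arcs-◅◅ c _ ⟨
      arcs w′
        ∎
      where open ≤-Reasoning

  Adjoins : List⁺ (Fin n) → List⁺ (Fin n) → Set
  Adjoins P Q = part (L⁺.last P) ≡ part (L⁺.head Q)

  flat : List (List⁺ (Fin n)) → List (Fin n)
  flat Ps = concat (map toList Ps)

  pathLength : List⁺ (Fin n) → ℕ
  pathLength P = L⁺.length P ∸ 1

  arcs-linked-walk : ∀ {x xs u} (l : Linked (Arc D) (x ∷ xs)) (s : Step (lastOf x xs) u) →
    arcs (linked-walk (Linked.map inj₁ l) s) ≡ length xs + weight s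
  arcs-linked-walk [-] s = +-identityʳ (weight s)
  arcs-linked-walk (_ ∷ l) s = cong suc (arcs-linked-walk l s)

  path-walk : ∀ P Q → IsPath D P → Adjoins P Q → Walk (L⁺.head P) (L⁺.head Q)
  path-walk P Q (_ , l) j =
    linked-walk (Linked.map inj₁ l) (inj₂ (trans (cong part (sym last≡)) j))
    where
    last≡ : L⁺.last P ≡ lastOf (L⁺.head P) (L⁺.tail P)
    last≡ = last≡lastOf (L⁺.head P) (L⁺.tail P)

  flatten : ∀ {P Q} (js : Star Adjoins P Q) → All (IsPath D) (sources js) →
    Walk (L⁺.head P) (L⁺.head Q)
  flatten ε [] = ε
  flatten {P} (_◅_ {j = Q} j js) (p ∷ ps) = path-walk P Q p j ◅◅ flatten js ps

  sources-flatten : ∀ {P Q} (js : Star Adjoins P Q) (ps : All (IsPath D) (sources js)) →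
    sources (flatten js ps) ≡ flat (sources js)
  sources-flatten ε [] = refl
  sources-flatten {P} (_◅_ {j = Q} j js) (p@(_ , l) ∷ ps) =
    trans (sources-◅◅ (path-walk P Q p j) _)
          (cong₂ _++_ (sources-linked-walk (Linked.map inj₁ l) _) (sources-flatten js ps))

  arcs-flatten : ∀ {P Q} (js : Star Adjoins P Q) (ps : All (IsPath D) (sources js)) →
    arcs (flatten js ps) ≡ sum (map pathLength (sources js))
  arcs-flatten ε [] = refl
  arcs-flatten {P} (_◅_ {j = Q} j js) (p@(_ , l) ∷ ps) =
    trans (arcs-◅◅ (path-walk P Q p j) _)
          (cong₂ _+_ (trans (arcs-linked-walk l _) (+-identityʳ _)) (arcs-flatten js ps))

  tour-of-gcycle : ∀ {g} → IsGCycle D part g →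
    Σ (Fin n) λ a → Σ (Walk a a) λ w → sources w ≡ vertices g × arcs w ≡ gLength g
  tour-of-gcycle {cycle (v ∷ vs)} (_ , _ , l , closing) =
    v , linked-walk (Linked.map inj₁ l) closing′
      , sources-linked-walk (Linked.map inj₁ l) closing′
      , trans (arcs-linked-walk l closing′) (+-comm (length vs) 1)
    where
    closing′ : Step (lastOf v vs) v
    closing′ = inj₁ (subst (λ t → Arc D t v) (last≡lastOf v vs) closing)
  tour-of-gcycle {paths (P ∷ Ps)} (ps , _ , l , closing) =
    L⁺.head P , flatten js ps′
              , trans (sources-flatten js ps′) (cong flat js-sources)
              , trans (arcs-flatten js ps′) (cong (λ Qs → sum (map pathLength Qs)) js-sources)
    where
    closing′ : Adjoins (lastOf P Ps) P
    closing′ = subst (λ t → Adjoins t P) (last≡lastOf P Ps) closing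
    js : Star Adjoins P P
    js = linked-walk l closing′
    js-sources : sources js ≡ P ∷ Ps
    js-sources = sources-linked-walk l closing′
    ps′ : All (IsPath D) (sources js)
    ps′ = subst (All (IsPath D)) (sym js-sources) ps

  extendHead : Fin n → List⁺ (List⁺ (Fin n)) → List⁺ (List⁺ (Fin n))
  extendHead u S = (u ∷⁺ L⁺.head S) ∷ L⁺.tail S

  segments : ∀ {u v} → Walk u v → List⁺ (List⁺ (Fin n))
  segments {u} ε = (u ∷ []) ∷ []
  segments {u} (inj₁ _ ◅ p) = extendHead u (segments p)
  segments {u} (inj₂ _ ◅ p) = (u ∷ []) ∷⁺ segments p

  vertices-segments : ∀ {u v} (p : Walk u v) →
    vertices (paths (segments p)) ≡ sources p ++ v ∷ []
  vertices-segments ε = refl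
  vertices-segments {u} (inj₁ _ ◅ p) = cong (u ∷_) (vertices-segments p)
  vertices-segments {u} (inj₂ _ ◅ p) = cong (u ∷_) (vertices-segments p)

  gLength-segments : ∀ {u v} (p : Walk u v) → gLength (paths (segments p)) ≡ arcs p
  gLength-segments ε = refl
  gLength-segments (inj₁ _ ◅ p) = cong suc (gLength-segments p)
  gLength-segments (inj₂ _ ◅ p) = gLength-segments p

  head-segments : ∀ {u v} (p : Walk u v) → L⁺.head (L⁺.head (segments p)) ≡ u
  head-segments ε = refl
  head-segments (inj₁ _ ◅ p) = refl
  head-segments (inj₂ _ ◅ p) = refl

  last-extendHead : ∀ u S → L⁺.last (L⁺.last (extendHead u S)) ≡ L⁺.last (L⁺.last S)
  last-extendHead u ((h ∷ hs) ∷ []) = last-∷ u h hs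
  last-extendHead u (H ∷ T ∷ Ts) =
    cong L⁺.last (trans (last-∷ (u ∷⁺ H) T Ts) (sym (last-∷ H T Ts)))

  last-segments : ∀ {u v} (p : Walk u v) → L⁺.last (L⁺.last (segments p)) ≡ v
  last-segments ε = refl
  last-segments {u} (inj₁ _ ◅ p) = trans (last-extendHead u (segments p)) (last-segments p)
  last-segments {u} (inj₂ _ ◅ p) = trans (cong L⁺.last (last-∷ (u ∷ []) H T)) (last-segments p)
    where
    H = L⁺.head (segments p)
    T = L⁺.tail (segments p)

  linked-extendHead : ∀ u S → Linked Adjoins (toList S) →
    Linked Adjoins (toList (extendHead u S))
  linked-extendHead u (H ∷ []) [-] = [-]
  linked-extendHead u ((h ∷ hs) ∷ T ∷ Ts) (j ∷ l) = trans (cong part (last-∷ u h hs)) j ∷ l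

  segments-adjoin : ∀ {u v} (p : Walk u v) → Linked Adjoins (toList (segments p))
  segments-adjoin ε = [-]
  segments-adjoin {u} (inj₁ _ ◅ p) = linked-extendHead u (segments p) (segments-adjoin p)
  segments-adjoin (inj₂ j ◅ p) = trans j (cong part (sym (head-segments p))) ∷ segments-adjoin p

  segments-arc-linked : ∀ {u v} (p : Walk u v) →
    All (λ P → Linked (Arc D) (toList P)) (toList (segments p))
  segments-arc-linked ε = [-] ∷ []
  segments-arc-linked {u} (inj₁ r ◅ p) with segments-arc-linked p
  ... | l ∷ ls = (subst (Arc D u) (sym (head-segments p)) r ∷ l) ∷ ls
  segments-arc-linked (inj₂ _ ◅ p) = [-] ∷ segments-arc-linked p

  segments-gcycle : ∀ {u v} (p : Walk u v) → part v ≡ part u → Unique (sources p ++ v ∷ []) →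
    IsGCycle D part (paths (segments p))
  segments-gcycle p j distinct =
    All.zip ( All.map⁻ (unique-concat⁻ (map toList (toList (segments p))) distinct′)
            , segments-arc-linked p )
    , distinct′
    , segments-adjoin p
    , trans (cong part (last-segments p)) (trans j (cong part (sym (head-segments p))))
    where
    distinct′ : Unique (vertices (paths (segments p)))
    distinct′ = subst Unique (sym (vertices-segments p)) distinct

  record Jump {a b} (w : Walk a b) : Set where
    constructor jump
    field
      {x y}  : Fin n
      before : Walk a x
      joint  : part x ≡ part y
      after  : Walk y b
      split  : w ≡ before ◅◅ inj₂ joint ◅ after

  jump-or-arcs : ∀ {a b} (w : Walk a b) →
    Jump w ⊎ Σ (Star (Arc D) a b) λ p → sources p ≡ sources w × arcs w ≡ length (sources p)
  jump-or-arcs ε = inj₂ (ε , refl , refl)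
  jump-or-arcs (inj₂ j ◅ w) = inj₁ (jump ε j w refl)
  jump-or-arcs {a} (inj₁ r ◅ w) with jump-or-arcs w
  ... | inj₁ (jump c j d e) = inj₁ (jump (inj₁ r ◅ c) j d (cong (inj₁ r ◅_) e))
  ... | inj₂ (p , s , e) = inj₂ (r ◅ p , cong (a ∷_) s , cong suc e)

  GCycleAbove : ℕ → ℕ → Set
  GCycleAbove len ord = Σ (GCycle n) λ g → IsGCycle D part g × len ≤ gLength g × ord ≤ gOrder g

  gcycle-of-jump : ∀ {a} (w : Walk a a) → Jump w → Unique (sources w) →
    GCycleAbove (arcs w) (length (sources w))
  gcycle-of-jump w (jump {x} c j d refl) distinct =
    paths (segments (d ◅◅ c)) , segments-gcycle (d ◅◅ c) j (Unique-resp-↭ perm distinct)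
    , ≤-reflexive (trans (arcs-◅◅-comm c (inj₂ j ◅ d)) (sym (gLength-segments (d ◅◅ c))))
    , ≤-reflexive (trans (↭-length perm) (sym (cong length (vertices-segments (d ◅◅ c)))))
    where
    perm : sources (c ◅◅ inj₂ j ◅ d) ↭ sources (d ◅◅ c) ++ x ∷ []
    perm = ↭-trans (sources-◅◅-comm c (inj₂ j ◅ d)) (∷↭∷ʳ x (sources (d ◅◅ c)))

  gcycle-of-circuit : ∀ {a} (p : Star (Arc D) a a) → Unique (sources p) →
    GCycleAbove (length (sources p)) (length (sources p))
  gcycle-of-circuit {a} ε _ =
    paths ((a ∷ []) ∷ []) , ((([] ∷ []) , [-]) ∷ [] , [] ∷ [] , [-] , refl) , z≤n , z≤n
  gcycle-of-circuit {a} (r ◅ ε) _ = ⊥-elim (noLoops D a r)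
  gcycle-of-circuit {a} (r ◅ p@(_ ◅ _)) distinct =
    cycle (a ∷ sources p) , (s≤s (s≤s z≤n) , distinct , walk-linked r p) , ≤-refl , ≤-refl

  gcycle-of-tour : ∀ {a} (w : Walk a a) → Unique (sources w) →
    GCycleAbove (arcs w) (length (sources w))
  gcycle-of-tour w distinct with jump-or-arcs w
  ... | inj₁ j = gcycle-of-jump w j distinct
  ... | inj₂ (p , s , e) with gcycle-of-circuit p (subst Unique (sym s) distinct)
  ...   | g , isG , len , ord =
    g , isG , subst (_≤ gLength g) (sym e) len , subst (_≤ gOrder g) (cong length s) ord

  gcycle-unique : ∀ {g} → IsGCycle D part g → Unique (vertices g)
  gcycle-unique {cycle _} (_ , distinct , _) = distinct
  gcycle-unique {paths _} (_ , distinct , _) = distinct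

  maximal-tour-of-maximum : ∀ {g a} (w : Walk a a) → IsMaximum D part g →
    sources w ≡ vertices g → arcs w ≡ gLength g → IsMaximalTour w
  maximal-tour-of-maximum {g} w ((isG , longest) , most) sources≡ arcs≡ =
    subst Unique (sym sources≡) (gcycle-unique isG) , bounded
    where
    bounded : ∀ {b} (w′ : Walk b b) → Unique (sources w′) → arcs w ≤ arcs w′ →
      length (sources w′) ≤ length (sources w)
    bounded w′ distinct heavier with gcycle-of-tour w′ distinct
    ... | g′ , isG′ , len , ord = begin
      length (sources w′)  ≤⟨ ord ⟩
      gOrder g′            ≤⟨ most g′ (isG′ , λ g″ isG″ → ≤-trans (longest g″ isG″) g≤g′) ⟩
      gOrder g             ≡⟨ cong length sources≡ ⟨
      length (sources w)   ∎
      where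
      open ≤-Reasoning
      g≤g′ : gLength g ≤ gLength g′
      g≤g′ = ≤-trans (≤-reflexive (sym arcs≡)) (≤-trans heavier len)

  base∈ : ∀ {a} (w : Walk a a) → IsMaximalTour w → a ∈ sources w
  base∈ {a} ε (_ , maximal) with maximal {a} (inj₂ refl ◅ ε) ([] ∷ []) z≤n
  ... | ()
  base∈ (_ ◅ _) _ = here refl

  module _ (smd : IsSMD D k part) where
    open IsSMD smd using (semicomplete)
    open import Data.List.Membership.DecPropositional (_≟ᶠ_ {n}) using (_∈?_)

    step-or-reverse : ∀ u v → Step u v ⊎ Arc D v u
    step-or-reverse u v with part u ≟ᶠ part v
    ... | yes e = inj₁ (inj₂ e)
    ... | no e≢ = Sum.map₁ inj₁ (semicomplete u v e≢)

    module MaximalTour {a} (w : Walk a a) (tour : IsMaximalTour w) where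

      no-detour : ∀ {x y u u′} → Link w x y → Arc D x u →
        (s : Step u u′) (d : Walk u′ y) →
        Unique (sources (s ◅ d)) → All (_∉ sources w) (sources (s ◅ d)) → ⊥
      no-detour l xu s d distinct-d fresh
        with insert-detour l xu (s ◅ d) (proj₁ tour) distinct-d fresh
      ... | w′ , distinct′ , heavier , larger =
        <⇒≱ (m<n+m _ (s≤s z≤n))
            (subst (_≤ length (sources w)) (sym larger) (proj₂ tour w′ distinct′ heavier))

      no-vertex-insertion : ∀ {x y v} → Link w x y → v ∉ sources w →
        Arc D x v → Step v y → ⊥
      no-vertex-insertion l v∉ xv vy = no-detour l xv vy ε ([] ∷ []) (v∉ ∷ [])

      no-arc-insertion : ∀ {x y z z′} → Link w x y → z ∉ sources w → z′ ∉ sources w →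
        Arc D x z → Arc D z z′ → Step z′ y → ⊥
      no-arc-insertion {z = z} l z∉ z′∉ xz zz′ z′y =
        no-detour l xz (inj₁ zz′) (z′y ◅ ε) ((z≢z′ ∷ []) ∷ [] ∷ []) (z∉ ∷ z′∉ ∷ [])
        where
        z≢z′ : z ≢ _
        z≢z′ refl = noLoops D z zz′

      Dominated : Fin n → Set
      Dominated v = ∀ {x} → x ∈ sources w → Arc D x v

      arc-from-tour⇒dominated : ∀ {x v} → v ∉ sources w → x ∈ sources w → Arc D x v →
        Dominated v
      arc-from-tour⇒dominated {v = v} v∉ x∈ xv = preserved-around w pres x∈ xv
        where
        pres : PreservedAlong (λ x → Arc D x v) w
        pres {y = y} l xv with step-or-reverse v y
        ... | inj₁ vy = ⊥-elim (no-vertex-insertion l v∉ xv vy)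
        ... | inj₂ yv = yv

      dominated-successor : ∀ {z z′} → z ∉ sources w → z′ ∉ sources w →
        Dominated z → Arc D z z′ → Dominated z′
      dominated-successor {z′ = z′} z∉ z′∉ dom zz′ {y} y∈
        with predecessor w y∈ | step-or-reverse z′ y
      ... | _ , l | inj₁ z′y =
        ⊥-elim (no-arc-insertion l z∉ z′∉ (dom (link-source∈ l)) zz′ z′y)
      ... | _ , _ | inj₂ yz′ = yz′

      dominated⇒no-arc-into-tour : ∀ {v y} → v ∉ sources w → Dominated v → Arc D v y →
        y ∉ sources w
      dominated⇒no-arc-into-tour v∉ dom vy y∈ with predecessor w y∈
      ... | _ , l = no-vertex-insertion l v∉ (dom (link-source∈ l)) (inj₁ vy)

      DominatedIfOutside : Fin n → Set
      DominatedIfOutside v = v ∉ sources w → Dominated v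

      DominatedOutside : Fin n → Set
      DominatedOutside v = v ∉ sources w × Dominated v

      dominatedIfOutside-step : ∀ {u v} → Arc D u v → DominatedIfOutside u → DominatedIfOutside v
      dominatedIfOutside-step {u} uv hyp v∉ with u ∈? sources w
      ... | yes u∈ = arc-from-tour⇒dominated v∉ u∈ uv
      ... | no u∉ = dominated-successor u∉ v∉ (hyp u∉) uv

      dominatedOutside-step : ∀ {u v} → Arc D u v → DominatedOutside u → DominatedOutside v
      dominatedOutside-step {v = v} uv (u∉ , dom) with v ∈? sources w
      ... | yes v∈ = ⊥-elim (dominated⇒no-arc-into-tour u∉ dom uv v∈)
      ... | no v∉ = v∉ , dominated-successor u∉ v∉ dom uv

      spanning : StronglyConnected D → ∀ v → v ∈ sources w
      spanning sc v with v ∈? sources w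
      ... | yes v∈ = v∈
      ... | no v∉ = ⊥-elim (proj₁ (preserved-to-end {P = DominatedOutside} (sc v a)
                              (λ l → dominatedOutside-step (Link.step l)) (v∉ , v-dominated)) a∈)
        where
        a∈ : a ∈ sources w
        a∈ = base∈ w tour
        v-dominated : Dominated v
        v-dominated = preserved-to-end {P = DominatedIfOutside} (sc a v)
          (λ l → dominatedIfOutside-step (Link.step l)) (λ a∉ → ⊥-elim (a∉ a∈)) v∉

lemma3p3 : ∀ {n k : ℕ} (D : Digraph n) (part : Fin n → Fin k) →
    IsSMD D k part → StronglyConnected D →
    ∀ (g : GCycle n) → IsMaximum D part g → Spanning g
lemma3p3 D part smd sc g maximum v with tour-of-gcycle D part (proj₁ (proj₁ maximum))
... | a , w , sources≡ , arcs≡ =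
  subst (v ∈_) sources≡ (MaximalTour.spanning D part smd w tour sc v)
  where
  tour : IsMaximalTour D part w
  tour = maximal-tour-of-maximum D part w maximum sources≡ arcs≡
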